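{- For every $S\in\{\mathbf{s}(0),\mathbf{s}(1),\mathbf{s}(2),\bar{\mathbf{s}}(0),\bar{\mathbf{s}}(1),\bar{\mathbf{s}}(2)\}$, every 2-terminal graph in $\mathcal{T}_S$ is minimally $S$-forcing with respect to $C_5$.
   Context: A $C_5$-colouring of $G$ is a map $\phi:V(G)\to\mathbb{Z}_5$ with $\phi(u)-\phi(v)=\pm1$ for every edge $uv$. A 2-terminal graph $(G,s,t)$ has two distinct distinguished vertices. Serial sum $(G_1,s_1,t_1)+(G_2,s_2,t_2)$ identifies $t_1$ with $s_2$, terminals $s_1,t_2$; parallel sum $G_1\,\|\,G_2$ identifies $s_1$ with $s_2$ and $t_1$ with $t_2$. For nonempty $S\subseteq\mathbb{Z}_5$, $(G,s,t)$ is $S$-forcing if $S=\{x:\exists$ a $C_5$-colouring $\phi$ of $G$ with $\phi(s)=0,\phi(t)=x\}$, minimally $S$-forcing if moreover no proper subgraph $(G',s,t)$ is $S$-forcing. $\mathbf{s}(i)=\{i,-i\}$, $\bar{\mathbf{s}}(i)=\mathbb{Z}_5\setminus\{i,-i\}$. The families $\mathcal{T}_{\mathbf{s}(0)},\mathcal{T}_{\bar{\mathbf{s}}(0)},\mathcal{T}_{\mathbf{s}(1)},\mathcal{T}_{\bar{\mathbf{s}}(1)},\mathcal{T}_{\mathbf{s}(2)},\mathcal{T}_{\bar{\mathbf{s}}(2)}$ are the minimal families of 2-terminal graphs such that $K_2\in\mathcal{T}_{\mathbf{s}(1)}$ and: (i) for distinct $i,j\in\{0,1,2\}$, $G\in\mathcal{T}_{\bar{\mathbf{s}}(i)}$,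 $H\in\mathcal{T}_{\bar{\mathbf{s}}(j)}$ imply $G\,\|\,H\in\mathcal{T}_{\mathbf{s}(\ell)}$, $\{\ell\}=\{0,1,2\}\setminus\{i,j\}$; (ii) $G,H\in\mathcal{T}_{\mathbf{s}(i)}$, $i\in\{1,2\}$, imply $G+H\in\mathcal{T}_{\bar{\mathbf{s}}(i)}$; (iii) $G\in\mathcal{T}_{\mathbf{s}(i)}$, $H\in\mathcal{T}_{\bar{\mathbf{s}}(i)}$, $i\in\{1,2\}$, imply $G+H\in\mathcal{T}_{\bar{\mathbf{s}}(0)}$; (iv) $G\in\mathcal{T}_S$ (any of the six $S$) and $H\in\mathcal{T}_{\mathbf{s}(0)}$ imply $G+H\in\mathcal{T}_S$. -}

module Defs where

open import Data.Nat using (ℕ; zero; suc; _+_)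
open import Data.Fin using (Fin; zero; suc; _↑ˡ_; _↑ʳ_; punchOut; splitAt)
open import Data.Fin.Properties using (_≟_; splitAt-↑ˡ; splitAt-↑ʳ)
open import Data.Fin.Subset using (Subset; ⁅_⁆; _∪_; ∁; _∈_)
open import Data.Bool using (Bool; true; false)
open import Data.List using (List; []; _∷_; map; _++_; length; lookup)
open import Data.Product using (_×_; _,_; proj₁; proj₂; Σ; ∃)
open import Data.Sum using (_⊎_; inj₁; inj₂)
open import Data.Empty using (⊥)
open import Relation.Nullary using (¬_; yes; no)
open import Relation.Binary.PropositionalEquality using (_≡_; _≢_; refl; cong; trans; sym)
open import Function.Bundles using (_⇔_)

Z5 : Set
Z5 = Fin 5

inc5 : Z5 → Z5
inc5 zero = suc zero
inc5 (suc zero) = suc (suc zero)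
inc5 (suc (suc zero)) = suc (suc (suc zero))
inc5 (suc (suc (suc zero))) = suc (suc (suc (suc zero)))
inc5 (suc (suc (suc (suc zero)))) = zero

neg5 : Z5 → Z5
neg5 zero = zero
neg5 (suc zero) = suc (suc (suc (suc zero)))
neg5 (suc (suc zero)) = suc (suc (suc zero))
neg5 (suc (suc (suc zero))) = suc (suc zero)
neg5 (suc (suc (suc (suc zero)))) = suc zero

Adj5 : Z5 → Z5 → Set
Adj5 a b = (a ≡ inc5 b) ⊎ (b ≡ inc5 a)

-- 2-terminal (multi)graphs.  Vertex set Fin (2 + k) (at least two
-- vertices, since the terminals are distinct); edges a finite list.

record TwoTerminal : Set where
  constructor mk2T
  field
    k     : ℕ
    edges : List (Fin (2 + k) × Fin (2 + k))
    s     : Fin (2 + k)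
    t     : Fin (2 + k)
    s≢t   : s ≢ t
open TwoTerminal public

K2 : TwoTerminal
K2 = mk2T 0 ((zero , suc zero) ∷ []) zero (suc zero) (λ ())

mapPair : ∀ {A B : Set} → (A → B) → A × A → B × B
mapPair f (a , b) = f a , f b

↑ˡ≢↑ʳ : ∀ {m n} (i : Fin m) (j : Fin n) → (i ↑ˡ n) ≢ (m ↑ʳ j)
↑ˡ≢↑ʳ {m} {n} i j eq with trans (sym (splitAt-↑ˡ m i n)) (trans (cong (splitAt m) eq) (splitAt-↑ʳ m n j))
... | ()

-- Serial sum: identify t₁ with s₂; terminals s₁, t₂.
serialV₂ : (G H : TwoTerminal) → Fin (2 + k H) → Fin (2 + (k G + suc (k H)))
serialV₂ G H v with s H ≟ v
... | yes _ = t G ↑ˡ suc (k H)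
... | no ne = (2 + k G) ↑ʳ punchOut ne

serialV₁ : (G H : TwoTerminal) → Fin (2 + k G) → Fin (2 + (k G + suc (k H)))
serialV₁ G H v = v ↑ˡ suc (k H)

serial-t : (G H : TwoTerminal) → Fin (2 + (k G + suc (k H)))
serial-t G H = (2 + k G) ↑ʳ punchOut (s≢t H)

_⊕_ : TwoTerminal → TwoTerminal → TwoTerminal
G ⊕ H = mk2T (k G + suc (k H))
             (map (mapPair (serialV₁ G H)) (edges G) ++ map (mapPair (serialV₂ G H)) (edges H))
             (serialV₁ G H (s G))
             (serial-t G H)
             (↑ˡ≢↑ʳ (s G) (punchOut (s≢t H)))

-- Parallel sum: identify s₁ with s₂ and t₁ with t₂; terminals s₁, t₁.
parallelV₂ : (G H : TwoTerminal) → Fin (2 + k H) → Fin (2 + (k G + k H))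
parallelV₂ G H v with s H ≟ v
... | yes _ = s G ↑ˡ k H
... | no ne with punchOut (s≢t H) ≟ punchOut ne
...   | yes _  = t G ↑ˡ k H
...   | no ne′ = (2 + k G) ↑ʳ punchOut ne′

_∥_ : TwoTerminal → TwoTerminal → TwoTerminal
G ∥ H = mk2T (k G + k H)
             (map (mapPair (λ v → v ↑ˡ k H)) (edges G) ++ map (mapPair (parallelV₂ G H)) (edges H))
             (s G ↑ˡ k H)
             (t G ↑ˡ k H)
             (λ eq → s≢t G (↑ˡ-injective eq))
  where
  ↑ˡ-injective : ∀ {a b : Fin (2 + k G)} → a ↑ˡ k H ≡ b ↑ˡ k H → a ≡ b
  ↑ˡ-injective {a} {b} eq with trans (sym (splitAt-↑ˡ (2 + k G) a (k H))) (trans (cong (splitAt (2 + k G)) eq) (splitAt-↑ˡ (2 + k G) b (k H)))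
  ... | refl = refl

record Subgraph (G : TwoTerminal) : Set where
  field
    vkeep : Fin (2 + k G) → Bool
    ekeep : Fin (length (edges G)) → Bool
    ends  : ∀ e → ekeep e ≡ true →
              (vkeep (proj₁ (lookup (edges G) e)) ≡ true) × (vkeep (proj₂ (lookup (edges G) e)) ≡ true)
    s-in  : vkeep (s G) ≡ true
    t-in  : vkeep (t G) ≡ true
open Subgraph public

whole : (G : TwoTerminal) → Subgraph G
whole G = record { vkeep = λ _ → true ; ekeep = λ _ → true
                 ; ends = λ _ _ → refl , refl ; s-in = refl ; t-in = refl }

Proper : {G : TwoTerminal} → Subgraph G → Set
Proper {G} H = (∃ λ v → vkeep H v ≡ false) ⊎ (∃ λ e → ekeep H e ≡ false)

record Colouring {G : TwoTerminal} (H : Subgraph G) : Set where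
  field
    φ   : (v : Fin (2 + k G)) → vkeep H v ≡ true → Z5
    ok  : ∀ e (p : ekeep H e ≡ true) →
            Adj5 (φ (proj₁ (lookup (edges G) e)) (proj₁ (ends H e p)))
                 (φ (proj₂ (lookup (edges G) e)) (proj₂ (ends H e p)))
open Colouring public

ForcingSub : {G : TwoTerminal} → Subset 5 → Subgraph G → Set
ForcingSub {G} S H = ∀ (x : Z5) →
  (x ∈ S) ⇔ (Σ (Colouring H) λ c → (φ c (s G) (s-in H) ≡ zero) × (φ c (t G) (t-in H) ≡ x))

Forcing : Subset 5 → TwoTerminal → Set
Forcing S G = ForcingSub S (whole G)

MinimallyForcing : Subset 5 → TwoTerminal → Set
MinimallyForcing S G = Forcing S G × (∀ (H : Subgraph G) → Proper H → ¬ ForcingSub S H)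

ι : Fin 3 → Z5
ι zero = zero
ι (suc zero) = suc zero
ι (suc (suc zero)) = suc (suc zero)

data Idx : Set where
  σ  : Fin 3 → Idx
  σ̄ : Fin 3 → Idx

𝐬 : Fin 3 → Subset 5
𝐬 i = ⁅ ι i ⁆ ∪ ⁅ neg5 (ι i) ⁆

setOf : Idx → Subset 5
setOf (σ i)  = 𝐬 i
setOf (σ̄ i) = ∁ (𝐬 i)

-- T I G : G ∈ 𝒯_{setOf I}; the least families closed under (i)-(iv)
data T : Idx → TwoTerminal → Set where
  base : T (σ (suc zero)) K2
  rule-i : ∀ {i j ℓ G H} → i ≢ j → i ≢ ℓ → j ≢ ℓ →
           T (σ̄ i) G → T (σ̄ j) H → T (σ ℓ) (G ∥ H)
  rule-ii : ∀ {i G H} → i ≢ zero → T (σ i) G → T (σ i) H → T (σ̄ i) (G ⊕ H)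
  rule-iii : ∀ {i G H} → i ≢ zero → T (σ i) G → T (σ̄ i) H → T (σ̄ zero) (G ⊕ H)
  rule-iv : ∀ {I G H} → T I G → T (σ zero) H → T I (G ⊕ H)

module Submission where

-- Induction on the derivation of G ∈ 𝒯_S proves more: G is S-forcing, deleting any
-- single edge admits a colouring with s ↦ 0 and t ↦ x for some x ∉ S, and every vertex
-- lies on an edge.  The last two clauses give minimality, because a proper subgraph misses
-- an edge and the colouring of G minus that edge restricts to it.  Colourings of a serial
-- (parallel) sum are exactly the compatible pairs of colourings of the summands, so the
-- set forced by G ⊕ H is S₁ + S₂ and the one forced by G ∥ H is S₁ ∩ S₂.  If deleting an
-- edge of G lets t take a value y ∉ S₁, then by the symmetry x ↦ −x of C₅ it also lets t
-- take −y, so the edge stays critical in the sum as soon as (S₁ ∪ {±y}) + S₂ ⊈ S, resp.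
-- (S₁ ∪ {±y}) ∩ S₂ ⊈ S.  For the rules (i)–(iv) these are finite checks in ℤ₅.

open import Defs
open import Data.Fin using (Fin; zero; suc; toℕ; _↑ˡ_; _↑ʳ_; splitAt; punchIn; punchOut)
open import Data.Fin.Properties
  using (all?; any?; _≟_; splitAt-↑ˡ; splitAt-↑ʳ; splitAt⁻¹-↑ˡ; splitAt⁻¹-↑ʳ;
         punchIn-punchOut; punchOut-punchIn; punchOut-cong; punchInᵢ≢i; punchOut-injective)
open import Data.Fin.Subset using (Subset; _∈_; _∉_; ⁅_⁆; _∪_; _∩_; ∁)
open import Data.Fin.Subset.Properties using (_∈?_; x∈p∪q⁻; x∈⁅y⁆⇒x≡y; x∈p∩q⁺; x∈p∩q⁻)
open import Data.Bool using (true; false)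
open import Data.List using (List; []; _∷_; map; _++_; length; removeAt; lookup)
open import Data.List.Membership.Propositional.Properties using (∈-lookup)
open import Data.List.Relation.Unary.All as All using (All; []; _∷_)
open import Data.List.Relation.Unary.All.Properties using (map⁺; map⁻; ++⁺; ++⁻)
open import Data.List.Relation.Unary.Any using (Any; here; index)
open import Data.List.Relation.Unary.Any.Properties using (gmap; ++⁺ˡ; ++⁺ʳ; lookup-index)
open import Data.Nat using (_+_)
open import Data.Nat.DivMod using (_mod_)
open import Data.Product using (Σ; ∃; ∃₂; _×_; _,_; proj₁; proj₂)
import Data.Product as Product
open import Data.Sum using (_⊎_; inj₁; inj₂)
import Data.Sum as Sum
open import Data.Empty using (⊥-elim)
open import Function using (_∘_; case_of_)
open import Function.Bundles using (mk⇔; Equivalence)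
open import Relation.Nullary using (¬_; Dec; yes; no; ¬?)
open import Relation.Nullary.Decidable using (from-yes; map′; _×-dec_; _⊎-dec_; _→-dec_)
open import Relation.Binary.PropositionalEquality
  using (_≡_; _≢_; _≗_; refl; sym; trans; cong; cong₂; subst; subst₂)

infixl 6 _+₅_ _-₅_

_+₅_ : Z5 → Z5 → Z5
a +₅ b = (toℕ a + toℕ b) mod 5

_-₅_ : Z5 → Z5 → Z5
a -₅ b = a +₅ neg5 b

±⁅_⁆ : Z5 → Subset 5
±⁅ y ⁆ = ⁅ y ⁆ ∪ ⁅ neg5 y ⁆

Adj5? : ∀ a b → Dec (Adj5 a b)
Adj5? a b = (a ≟ inc5 b) ⊎-dec (b ≟ inc5 a)

+₅-identityʳ : ∀ a → a +₅ zero ≡ a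
+₅-identityʳ = from-yes (all? λ a → a +₅ zero ≟ a)

-₅-telescope : ∀ x y z → (y -₅ x) +₅ (z -₅ y) ≡ z -₅ x
-₅-telescope = from-yes (all? λ x → all? λ y → all? λ z → (y -₅ x) +₅ (z -₅ y) ≟ z -₅ x)

Adj5-shift : ∀ c {a b} → Adj5 a b → Adj5 (c +₅ a) (c +₅ b)
Adj5-shift c {a} {b} =
  from-yes (all? λ c → all? λ a → all? λ b → Adj5? a b →-dec Adj5? (c +₅ a) (c +₅ b)) c a b

Adj5-neg : ∀ {a b} → Adj5 a b → Adj5 (neg5 a) (neg5 b)
Adj5-neg {a} {b} = from-yes (all? λ a → all? λ b → Adj5? a b →-dec Adj5? (neg5 a) (neg5 b)) a b

module _ {A : Set} {P : A → Set} where

  All-removeAt : ∀ {xs} → All P xs → ∀ e → All P (removeAt xs e)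
  All-removeAt (px ∷ pxs) zero    = pxs
  All-removeAt (px ∷ pxs) (suc e) = px ∷ All-removeAt pxs e

  All-removeAt-lookup : ∀ xs {e} → All P (removeAt xs e) → ∀ e′ → e′ ≢ e → P (lookup xs e′)
  All-removeAt-lookup (x ∷ xs) {zero}  pxs        zero     e′≢e = ⊥-elim (e′≢e refl)
  All-removeAt-lookup (x ∷ xs) {zero}  pxs        (suc e′) _    = All.lookup pxs (∈-lookup e′)
  All-removeAt-lookup (x ∷ xs) {suc e} (px ∷ pxs) zero     _    = px
  All-removeAt-lookup (x ∷ xs) {suc e} (px ∷ pxs) (suc e′) e′≢e =
    All-removeAt-lookup xs pxs e′ (e′≢e ∘ cong suc)

  All-tabulate-lookup : ∀ xs → (∀ e → P (lookup xs e)) → All P xs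
  All-tabulate-lookup xs h =
    All.tabulate λ x∈xs → subst P (sym (lookup-index x∈xs)) (h (index x∈xs))

removeAt-++-map : ∀ {A B C : Set} (g : A → C) (h : B → C) xs ys
                  (e : Fin (length (map g xs ++ map h ys))) →
    (∃ λ e₁ → removeAt (map g xs ++ map h ys) e ≡ map g (removeAt xs e₁) ++ map h ys)
  ⊎ (∃ λ e₂ → removeAt (map g xs ++ map h ys) e ≡ map g xs ++ map h (removeAt ys e₂))
removeAt-++-map g h [] (y ∷ ys) zero = inj₂ (zero , refl)
removeAt-++-map g h [] (y ∷ ys) (suc e) with removeAt-++-map g h [] ys e
... | inj₂ (e₂ , eq) = inj₂ (suc e₂ , cong (h y ∷_) eq)
removeAt-++-map g h (x ∷ xs) ys zero = inj₁ (zero , refl)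
removeAt-++-map g h (x ∷ xs) ys (suc e) =
  Sum.map (Product.map suc (cong (g x ∷_))) (Product.map₂ (cong (g x ∷_)))
          (removeAt-++-map g h xs ys e)

Vertex : TwoTerminal → Set
Vertex G = Fin (2 + k G)

Respects : {V : Set} → (V → Z5) → V × V → Set
Respects f (u , v) = Adj5 (f u) (f v)

Colours : {V : Set} → List (V × V) → (V → Z5) → Set
Colours es f = All (Respects f) es

Incident : {V : Set} → V → V × V → Set
Incident w (u , v) = u ≡ w ⊎ v ≡ w

Realises : (G : TwoTerminal) → List (Vertex G × Vertex G) → Z5 → Set
Realises G es x = ∃ λ f → Colours es f × f (s G) ≡ zero × f (t G) ≡ x

Escapes : Subset 5 → (G : TwoTerminal) → List (Vertex G × Vertex G) → Set
Escapes S G es = ∃ λ x → x ∉ S × Realises G es x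

respects-≗ : ∀ {V} {f g : V → Z5} → f ≗ g → ∀ {p} → Respects f p → Respects g p
respects-≗ f≗g {u , v} = subst₂ Adj5 (f≗g u) (f≗g v)

record CriticallyForcing (S : Subset 5) (G : TwoTerminal) : Set where
  field
    -- for all colourings, not only those with s ↦ 0: in a serial sum the second summand
    -- is coloured from the colour of the identified vertex
    sound    : ∀ f → Colours (edges G) f → f (t G) -₅ f (s G) ∈ S
    complete : ∀ x → x ∈ S → Realises G (edges G) x
    critical : ∀ e → Escapes S G (removeAt (edges G) e)
    covered  : ∀ v → Any (Incident v) (edges G)
open CriticallyForcing

removeAt-realises : ∀ {S G} → CriticallyForcing S G → ∀ e →
  ∃ λ y → y ∉ S × (∀ z → z ∈ S ∪ ±⁅ y ⁆ → Realises G (removeAt (edges G) e) z)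
removeAt-realises {S} {G} cf e with critical cf e
... | _ , y∉S , f , c , fs , refl = f (t G) , y∉S , realise
  where
  realise : ∀ z → z ∈ S ∪ ±⁅ f (t G) ⁆ → Realises G (removeAt (edges G) e) z
  realise z z∈ with x∈p∪q⁻ S _ z∈
  ... | inj₁ z∈S = Product.map₂ (Product.map₁ (λ cg → All-removeAt cg e)) (complete cf z z∈S)
  ... | inj₂ z∈±y with x∈p∪q⁻ ⁅ f (t G) ⁆ _ z∈±y
  ...   | inj₁ z∈⁅y⁆  = f , c , fs , sym (x∈⁅y⁆⇒x≡y _ z∈⁅y⁆)
  ...   | inj₂ z∈⁅-y⁆ = neg5 ∘ f , All.map Adj5-neg c , cong neg5 fs , sym (x∈⁅y⁆⇒x≡y _ z∈⁅-y⁆)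

glue : {A B C : Set} → (A → C) → (B → C) → List (A × A) → List (B × B) → List (C × C)
glue m₁ m₂ xs ys = map (mapPair m₁) xs ++ map (mapPair m₂) ys

module _ {A B C : Set} {m₁ : A → C} {m₂ : B → C} where

  colours-glue : ∀ {xs ys f f₁ f₂} → f ∘ m₁ ≗ f₁ → f ∘ m₂ ≗ f₂ →
                 Colours xs f₁ → Colours ys f₂ → Colours (glue m₁ m₂ xs ys) f
  colours-glue eq₁ eq₂ c₁ c₂ =
    ++⁺ (map⁺ (All.map (respects-≗ (sym ∘ eq₁)) c₁)) (map⁺ (All.map (respects-≗ (sym ∘ eq₂)) c₂))

  colours-unglue : ∀ xs {ys f} → Colours (glue m₁ m₂ xs ys) f →
                   Colours xs (f ∘ m₁) × Colours ys (f ∘ m₂)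
  colours-unglue xs c = Product.map map⁻ map⁻ (++⁻ (map (mapPair m₁) xs) c)

  covered-glue : ∀ {xs ys} → (∀ w → (∃ λ v → m₁ v ≡ w) ⊎ (∃ λ v → m₂ v ≡ w)) →
                 (∀ v → Any (Incident v) xs) → (∀ v → Any (Incident v) ys) →
                 ∀ w → Any (Incident w) (glue m₁ m₂ xs ys)
  covered-glue onto cov₁ cov₂ w with onto w
  ... | inj₁ (v , refl) = ++⁺ˡ (gmap (Sum.map (cong m₁) (cong m₁)) (cov₁ v))
  ... | inj₂ (v , refl) = ++⁺ʳ _ (gmap (Sum.map (cong m₂) (cong m₂)) (cov₂ v))

critical-glue : ∀ {A B : Set} {S} K {m₁ : A → Vertex K} {m₂ : B → Vertex K} xs ys →
  (∀ e₁ → Escapes S K (glue m₁ m₂ (removeAt xs e₁) ys)) →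
  (∀ e₂ → Escapes S K (glue m₁ m₂ xs (removeAt ys e₂))) →
  ∀ e → Escapes S K (removeAt (glue m₁ m₂ xs ys) e)
critical-glue {S = S} K {m₁} {m₂} xs ys escape₁ escape₂ e
  with removeAt-++-map (mapPair m₁) (mapPair m₂) xs ys e
... | inj₁ (e₁ , eq) = subst (Escapes S K) (sym eq) (escape₁ e₁)
... | inj₂ (e₂ , eq) = subst (Escapes S K) (sym eq) (escape₂ e₂)

record SerialRule (S₁ S₂ S : Subset 5) : Set where
  constructor mkSerialRule
  field
    sum-⊆     : ∀ a b → a ∈ S₁ → b ∈ S₂ → a +₅ b ∈ S
    ⊆-sum     : ∀ x → x ∈ S → ∃₂ λ a b → a ∈ S₁ × b ∈ S₂ × a +₅ b ≡ x
    criticalˡ : ∀ y → y ∉ S₁ → ∃₂ λ z w → z ∈ S₁ ∪ ±⁅ y ⁆ × w ∈ S₂ × z +₅ w ∉ S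
    criticalʳ : ∀ y → y ∉ S₂ → ∃₂ λ z w → z ∈ S₁ × w ∈ S₂ ∪ ±⁅ y ⁆ × z +₅ w ∉ S

serialRule? : ∀ S₁ S₂ S → Dec (SerialRule S₁ S₂ S)
serialRule? S₁ S₂ S =
  map′ (λ (a , b , c , d) → mkSerialRule a b c d)
       (λ r → let open SerialRule r in sum-⊆ , ⊆-sum , criticalˡ , criticalʳ)
       ( (all? λ a → all? λ b → (a ∈? S₁) →-dec ((b ∈? S₂) →-dec (a +₅ b ∈? S)))
  ×-dec ((all? λ x → (x ∈? S) →-dec any? λ a → any? λ b →
           (a ∈? S₁) ×-dec ((b ∈? S₂) ×-dec (a +₅ b ≟ x)))
  ×-dec ((all? λ y → ¬? (y ∈? S₁) →-dec any? λ z → any? λ w →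
           (z ∈? S₁ ∪ ±⁅ y ⁆) ×-dec ((w ∈? S₂) ×-dec ¬? (z +₅ w ∈? S)))
  ×-dec  (all? λ y → ¬? (y ∈? S₂) →-dec any? λ z → any? λ w →
           (z ∈? S₁) ×-dec ((w ∈? S₂ ∪ ±⁅ y ⁆) ×-dec ¬? (z +₅ w ∈? S))))))

record ParallelRule (S₁ S₂ S : Subset 5) : Set where
  constructor mkParallelRule
  field
    ∩-⊆       : ∀ x → x ∈ S₁ ∩ S₂ → x ∈ S
    ⊆-∩       : ∀ x → x ∈ S → x ∈ S₁ ∩ S₂
    criticalˡ : ∀ y → y ∉ S₁ → ∃ λ z → z ∈ S₁ ∪ ±⁅ y ⁆ × z ∈ S₂ × z ∉ S
    criticalʳ : ∀ y → y ∉ S₂ → ∃ λ z → z ∈ S₁ × z ∈ S₂ ∪ ±⁅ y ⁆ × z ∉ S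

parallelRule? : ∀ S₁ S₂ S → Dec (ParallelRule S₁ S₂ S)
parallelRule? S₁ S₂ S =
  map′ (λ (a , b , c , d) → mkParallelRule a b c d)
       (λ r → let open ParallelRule r in ∩-⊆ , ⊆-∩ , criticalˡ , criticalʳ)
       ( (all? λ x → (x ∈? S₁ ∩ S₂) →-dec (x ∈? S))
  ×-dec ((all? λ x → (x ∈? S) →-dec (x ∈? S₁ ∩ S₂))
  ×-dec ((all? λ y → ¬? (y ∈? S₁) →-dec any? λ z →
           (z ∈? S₁ ∪ ±⁅ y ⁆) ×-dec ((z ∈? S₂) ×-dec ¬? (z ∈? S)))
  ×-dec  (all? λ y → ¬? (y ∈? S₂) →-dec any? λ z →
           (z ∈? S₁) ×-dec ((z ∈? S₂ ∪ ±⁅ y ⁆) ×-dec ¬? (z ∈? S))))))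

parallel-rule-i : ∀ i j ℓ → i ≢ j → i ≢ ℓ → j ≢ ℓ → ParallelRule (∁ (𝐬 i)) (∁ (𝐬 j)) (𝐬 ℓ)
parallel-rule-i = from-yes (all? λ i → all? λ j → all? λ ℓ →
  ¬? (i ≟ j) →-dec (¬? (i ≟ ℓ) →-dec (¬? (j ≟ ℓ) →-dec parallelRule? (∁ (𝐬 i)) (∁ (𝐬 j)) (𝐬 ℓ))))

serial-rule-ii : ∀ i → i ≢ zero → SerialRule (𝐬 i) (𝐬 i) (∁ (𝐬 i))
serial-rule-ii = from-yes (all? λ i → ¬? (i ≟ zero) →-dec serialRule? (𝐬 i) (𝐬 i) (∁ (𝐬 i)))

serial-rule-iii : ∀ i → i ≢ zero → SerialRule (𝐬 i) (∁ (𝐬 i)) (∁ (𝐬 zero))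
serial-rule-iii = from-yes (all? λ i → ¬? (i ≟ zero) →-dec serialRule? (𝐬 i) (∁ (𝐬 i)) (∁ (𝐬 zero)))

serial-rule-iv : ∀ I → SerialRule (setOf I) (𝐬 zero) (setOf I)
serial-rule-iv (σ i)  = from-yes (all? λ i → serialRule? (𝐬 i) (𝐬 zero) (𝐬 i)) i
serial-rule-iv (σ̄ i) = from-yes (all? λ i → serialRule? (∁ (𝐬 i)) (𝐬 zero) (∁ (𝐬 i))) i

module Serial (G H : TwoTerminal) where

  m₁ : Vertex G → Vertex (G ⊕ H)
  m₁ = serialV₁ G H

  m₂ : Vertex H → Vertex (G ⊕ H)
  m₂ = serialV₂ G H

  m₂-s : m₂ (s H) ≡ m₁ (t G)
  m₂-s with s H ≟ s H
  ... | yes _   = refl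
  ... | no s≢s = ⊥-elim (s≢s refl)

  m₂-t : m₂ (t H) ≡ t (G ⊕ H)
  m₂-t with s H ≟ t H
  ... | yes s≡t = ⊥-elim (s≢t H s≡t)
  ... | no _    = cong ((2 + k G) ↑ʳ_) (punchOut-cong (s H) refl)

  m₂-punchIn : ∀ j → m₂ (punchIn (s H) j) ≡ (2 + k G) ↑ʳ j
  m₂-punchIn j with s H ≟ punchIn (s H) j
  ... | yes s≡j = ⊥-elim (punchInᵢ≢i (s H) j (sym s≡j))
  ... | no _    = cong ((2 + k G) ↑ʳ_) (trans (punchOut-cong (s H) refl) (punchOut-punchIn (s H)))

  onto : ∀ w → (∃ λ v → m₁ v ≡ w) ⊎ (∃ λ v → m₂ v ≡ w)
  onto w with splitAt (2 + k G) w in eq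
  ... | inj₁ v = inj₁ (v , splitAt⁻¹-↑ˡ eq)
  ... | inj₂ j = inj₂ (punchIn (s H) j , trans (m₂-punchIn j) (splitAt⁻¹-↑ʳ eq))

  join : (Vertex G → Z5) → (Vertex H → Z5) → Vertex (G ⊕ H) → Z5
  join f₁ f₂ w with splitAt (2 + k G) w
  ... | inj₁ v = f₁ v
  ... | inj₂ j = f₁ (t G) +₅ f₂ (punchIn (s H) j)

  join-m₁ : ∀ f₁ f₂ → join f₁ f₂ ∘ m₁ ≗ f₁
  join-m₁ f₁ f₂ v rewrite splitAt-↑ˡ (2 + k G) v (1 + k H) = refl

  join-m₂ : ∀ f₁ f₂ → f₂ (s H) ≡ zero → join f₁ f₂ ∘ m₂ ≗ (f₁ (t G) +₅_) ∘ f₂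
  join-m₂ f₁ f₂ f₂s≡0 v with s H ≟ v
  ... | yes refl rewrite splitAt-↑ˡ (2 + k G) (t G) (1 + k H) | f₂s≡0 = sym (+₅-identityʳ (f₁ (t G)))
  ... | no s≢v   rewrite splitAt-↑ʳ (2 + k G) (1 + k H) (punchOut s≢v) | punchIn-punchOut s≢v = refl

  realise : ∀ {es₁ es₂ a b} → Realises G es₁ a → Realises H es₂ b →
            Realises (G ⊕ H) (glue m₁ m₂ es₁ es₂) (a +₅ b)
  realise (f₁ , c₁ , f₁s≡0 , refl) (f₂ , c₂ , f₂s≡0 , refl) =
    join f₁ f₂ ,
    colours-glue (join-m₁ f₁ f₂) (join-m₂ f₁ f₂ f₂s≡0) c₁ (All.map (Adj5-shift (f₁ (t G))) c₂) ,
    trans (join-m₁ f₁ f₂ (s G)) f₁s≡0 ,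
    trans (cong (join f₁ f₂) (sym m₂-t)) (join-m₂ f₁ f₂ f₂s≡0 (t H))

⊕-critical : ∀ {S₁ S₂ S G H} → CriticallyForcing S₁ G → CriticallyForcing S₂ H →
             SerialRule S₁ S₂ S → CriticallyForcing S (G ⊕ H)
⊕-critical {S₁} {S₂} {S} {G} {H} cf₁ cf₂ rule = record
  { sound    = sound′
  ; complete = complete′
  ; critical = critical-glue (G ⊕ H) (edges G) (edges H) escape₁ escape₂
  ; covered  = covered-glue onto (covered cf₁) (covered cf₂)
  }
  where
  open Serial G H
  open SerialRule rule

  sound′ : ∀ f → Colours (edges (G ⊕ H)) f → f (t (G ⊕ H)) -₅ f (s (G ⊕ H)) ∈ S
  sound′ f c with colours-unglue (edges G) c
  ... | c₁ , c₂ = subst (_∈ S) (-₅-telescope (f (s (G ⊕ H))) middle (f (t (G ⊕ H))))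
                        (sum-⊆ _ _ (sound cf₁ _ c₁) second)
    where
    middle : Z5
    middle = f (m₁ (t G))

    second : f (t (G ⊕ H)) -₅ middle ∈ S₂
    second = subst₂ (λ b a → b -₅ a ∈ S₂) (cong f m₂-t) (cong f m₂-s) (sound cf₂ _ c₂)

  complete′ : ∀ x → x ∈ S → Realises (G ⊕ H) (edges (G ⊕ H)) x
  complete′ x x∈S with ⊆-sum x x∈S
  ... | a , b , a∈S₁ , b∈S₂ , refl = realise (complete cf₁ a a∈S₁) (complete cf₂ b b∈S₂)

  escape₁ : ∀ e₁ → Escapes S (G ⊕ H) (glue m₁ m₂ (removeAt (edges G) e₁) (edges H))
  escape₁ e₁ with removeAt-realises cf₁ e₁
  ... | y , y∉S₁ , range with criticalˡ y y∉S₁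
  ... | z , w , z∈ , w∈S₂ , z+w∉S = z +₅ w , z+w∉S , realise (range z z∈) (complete cf₂ w w∈S₂)

  escape₂ : ∀ e₂ → Escapes S (G ⊕ H) (glue m₁ m₂ (edges G) (removeAt (edges H) e₂))
  escape₂ e₂ with removeAt-realises cf₂ e₂
  ... | y , y∉S₂ , range with criticalʳ y y∉S₂
  ... | z , w , z∈S₁ , w∈ , z+w∉S = z +₅ w , z+w∉S , realise (complete cf₁ z z∈S₁) (range w w∈)

module Parallel (G H : TwoTerminal) where

  m₁ : Vertex G → Vertex (G ∥ H)
  m₁ v = v ↑ˡ k H

  m₂ : Vertex H → Vertex (G ∥ H)
  m₂ = parallelV₂ G H

  inner : Fin (k H) → Vertex H
  inner j = punchIn (s H) (punchIn (punchOut (s≢t H)) j)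

  m₂-s : m₂ (s H) ≡ m₁ (s G)
  m₂-s with s H ≟ s H
  ... | yes _   = refl
  ... | no s≢s = ⊥-elim (s≢s refl)

  m₂-t : m₂ (t H) ≡ m₁ (t G)
  m₂-t with s H ≟ t H
  ... | yes s≡t = ⊥-elim (s≢t H s≡t)
  ... | no s≢t′ with punchOut (s≢t H) ≟ punchOut s≢t′
  ...   | yes _ = refl
  ...   | no ≢  = ⊥-elim (≢ (punchOut-cong (s H) refl))

  m₂-inner : ∀ j → m₂ (inner j) ≡ (2 + k G) ↑ʳ j
  m₂-inner j with s H ≟ inner j
  ... | yes s≡j = ⊥-elim (punchInᵢ≢i (s H) _ (sym s≡j))
  ... | no s≢j with punchOut (s≢t H) ≟ punchOut s≢j
  ...   | yes t≡j = ⊥-elim (punchInᵢ≢i (punchOut (s≢t H)) j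
                      (sym (trans t≡j (trans (punchOut-cong (s H) refl) (punchOut-punchIn (s H))))))
  ...   | no _    = cong ((2 + k G) ↑ʳ_)
                      (trans (punchOut-cong (punchOut (s≢t H))
                               (trans (punchOut-cong (s H) refl) (punchOut-punchIn (s H))))
                             (punchOut-punchIn (punchOut (s≢t H))))

  onto : ∀ w → (∃ λ v → m₁ v ≡ w) ⊎ (∃ λ v → m₂ v ≡ w)
  onto w with splitAt (2 + k G) w in eq
  ... | inj₁ v = inj₁ (v , splitAt⁻¹-↑ˡ eq)
  ... | inj₂ j = inj₂ (inner j , trans (m₂-inner j) (splitAt⁻¹-↑ʳ eq))

  join : (Vertex G → Z5) → (Vertex H → Z5) → Vertex (G ∥ H) → Z5
  join f₁ f₂ w with splitAt (2 + k G) w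
  ... | inj₁ v = f₁ v
  ... | inj₂ j = f₂ (inner j)

  join-m₁ : ∀ f₁ f₂ → join f₁ f₂ ∘ m₁ ≗ f₁
  join-m₁ f₁ f₂ v rewrite splitAt-↑ˡ (2 + k G) v (k H) = refl

  join-m₂ : ∀ f₁ f₂ → f₁ (s G) ≡ f₂ (s H) → f₁ (t G) ≡ f₂ (t H) → join f₁ f₂ ∘ m₂ ≗ f₂
  join-m₂ f₁ f₂ s₁≡s₂ t₁≡t₂ v with s H ≟ v
  ... | yes refl rewrite splitAt-↑ˡ (2 + k G) (s G) (k H) = s₁≡s₂
  ... | no s≢v with punchOut (s≢t H) ≟ punchOut s≢v
  ...   | yes t≡v rewrite splitAt-↑ˡ (2 + k G) (t G) (k H)
                        | punchOut-injective (s≢t H) s≢v t≡v = t₁≡t₂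
  ...   | no t≢v  rewrite splitAt-↑ʳ (2 + k G) (k H) (punchOut t≢v)
                        | punchIn-punchOut t≢v | punchIn-punchOut s≢v = refl

  realise : ∀ {es₁ es₂ x} → Realises G es₁ x → Realises H es₂ x →
            Realises (G ∥ H) (glue m₁ m₂ es₁ es₂) x
  realise (f₁ , c₁ , f₁s≡0 , f₁t≡x) (f₂ , c₂ , f₂s≡0 , f₂t≡x) =
    join f₁ f₂ ,
    colours-glue (join-m₁ f₁ f₂) (join-m₂ f₁ f₂ (trans f₁s≡0 (sym f₂s≡0)) (trans f₁t≡x (sym f₂t≡x))) c₁ c₂ ,
    trans (join-m₁ f₁ f₂ (s G)) f₁s≡0 ,
    trans (join-m₁ f₁ f₂ (t G)) f₁t≡x

∥-critical : ∀ {S₁ S₂ S G H} → CriticallyForcing S₁ G → CriticallyForcing S₂ H →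
             ParallelRule S₁ S₂ S → CriticallyForcing S (G ∥ H)
∥-critical {S₁} {S₂} {S} {G} {H} cf₁ cf₂ rule = record
  { sound    = sound′
  ; complete = complete′
  ; critical = critical-glue (G ∥ H) (edges G) (edges H) escape₁ escape₂
  ; covered  = covered-glue onto (covered cf₁) (covered cf₂)
  }
  where
  open Parallel G H
  open ParallelRule rule

  sound′ : ∀ f → Colours (edges (G ∥ H)) f → f (t (G ∥ H)) -₅ f (s (G ∥ H)) ∈ S
  sound′ f c with colours-unglue (edges G) c
  ... | c₁ , c₂ = ∩-⊆ _ (x∈p∩q⁺ (sound cf₁ _ c₁ , second))
    where
    second : f (t (G ∥ H)) -₅ f (s (G ∥ H)) ∈ S₂
    second = subst₂ (λ b a → b -₅ a ∈ S₂) (cong f m₂-t) (cong f m₂-s) (sound cf₂ _ c₂)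

  complete′ : ∀ x → x ∈ S → Realises (G ∥ H) (edges (G ∥ H)) x
  complete′ x x∈S with x∈p∩q⁻ S₁ S₂ (⊆-∩ x x∈S)
  ... | x∈S₁ , x∈S₂ = realise (complete cf₁ x x∈S₁) (complete cf₂ x x∈S₂)

  escape₁ : ∀ e₁ → Escapes S (G ∥ H) (glue m₁ m₂ (removeAt (edges G) e₁) (edges H))
  escape₁ e₁ with removeAt-realises cf₁ e₁
  ... | y , y∉S₁ , range with criticalˡ y y∉S₁
  ... | z , z∈ , z∈S₂ , z∉S = z , z∉S , realise (range z z∈) (complete cf₂ z z∈S₂)

  escape₂ : ∀ e₂ → Escapes S (G ∥ H) (glue m₁ m₂ (edges G) (removeAt (edges H) e₂))
  escape₂ e₂ with removeAt-realises cf₂ e₂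
  ... | y , y∉S₂ , range with criticalʳ y y∉S₂
  ... | z , z∈S₁ , z∈ , z∉S = z , z∉S , realise (complete cf₁ z z∈S₁) (range z z∈)

K2-critical : CriticallyForcing (𝐬 (suc zero)) K2
K2-critical = record
  { sound    = λ { f (adj ∷ []) → difference-of-adjacent _ _ adj }
  ; complete = λ x x∈ → (λ { zero → zero ; (suc _) → x }) , adjacent-to-zero x x∈ ∷ [] , refl , refl
  ; critical = λ { zero → zero , zero∉ , (λ _ → zero) , [] , refl , refl }
  ; covered  = λ { zero → here (inj₁ refl) ; (suc zero) → here (inj₂ refl) }
  }
  where
  difference-of-adjacent : ∀ a b → Adj5 a b → b -₅ a ∈ 𝐬 (suc zero)
  difference-of-adjacent = from-yes (all? λ a → all? λ b → Adj5? a b →-dec (b -₅ a ∈? 𝐬 (suc zero)))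
  adjacent-to-zero : ∀ x → x ∈ 𝐬 (suc zero) → Adj5 zero x
  adjacent-to-zero = from-yes (all? λ x → (x ∈? 𝐬 (suc zero)) →-dec Adj5? zero x)
  zero∉ : zero ∉ 𝐬 (suc zero)
  zero∉ = from-yes (¬? (zero ∈? 𝐬 (suc zero)))

T⇒critical : ∀ {I G} → T I G → CriticallyForcing (setOf I) G
T⇒critical base = K2-critical
T⇒critical (rule-i {i} {j} {ℓ} i≢j i≢ℓ j≢ℓ dG dH) =
  ∥-critical (T⇒critical dG) (T⇒critical dH) (parallel-rule-i i j ℓ i≢j i≢ℓ j≢ℓ)
T⇒critical (rule-ii {i} i≢0 dG dH) = ⊕-critical (T⇒critical dG) (T⇒critical dH) (serial-rule-ii i i≢0)
T⇒critical (rule-iii {i} i≢0 dG dH) = ⊕-critical (T⇒critical dG) (T⇒critical dH) (serial-rule-iii i i≢0)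
T⇒critical (rule-iv {I} dG dH) = ⊕-critical (T⇒critical dG) (T⇒critical dH) (serial-rule-iv I)

colouring : ∀ {G} (H : Subgraph G) (f : Vertex G → Z5) →
            (∀ e → ekeep H e ≡ true → Respects f (lookup (edges G) e)) → Colouring H
colouring H f respects = record { φ = λ v _ → f v ; ok = respects }

critical⇒forcing : ∀ {S G} → CriticallyForcing S G → Forcing S G
critical⇒forcing {S} {G} cf x = mk⇔ realised sound-at-x
  where
  realised : x ∈ S → Σ (Colouring (whole G)) λ c → φ c (s G) refl ≡ zero × φ c (t G) refl ≡ x
  realised x∈S with complete cf x x∈S
  ... | f , c , fs≡0 , ft≡x = colouring (whole G) f (λ e _ → All.lookup c (∈-lookup e)) , fs≡0 , ft≡x
  sound-at-x : Σ (Colouring (whole G)) (λ c → φ c (s G) refl ≡ zero × φ c (t G) refl ≡ x) → x ∈ S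
  sound-at-x (c , cs≡0 , ct≡x) =
    subst (_∈ S) (trans (cong₂ _-₅_ ct≡x cs≡0) (+₅-identityʳ x))
          (sound cf (λ v → φ c v refl) (All-tabulate-lookup (edges G) λ e → ok c e refl))

proper⇒missing-edge : ∀ {G} → (∀ v → Any (Incident v) (edges G)) → (H : Subgraph G) → Proper H →
                      ∃ λ e → ekeep H e ≡ false
proper⇒missing-edge cov H (inj₂ dropped) = dropped
proper⇒missing-edge {G} cov H (inj₁ (v , v∉H)) = index (cov v) , edge-dropped
  where
  e : Fin (length (edges G))
  e = index (cov v)
  edge-dropped : ekeep H e ≡ false
  edge-dropped with ekeep H e in kept | lookup-index (cov v)
  ... | false | _      = refl
  ... | true  | inj₁ u≡v =
    case trans (sym (proj₁ (ends H e kept))) (trans (cong (vkeep H) u≡v) v∉H) of λ ()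
  ... | true  | inj₂ w≡v =
    case trans (sym (proj₂ (ends H e kept))) (trans (cong (vkeep H) w≡v) v∉H) of λ ()

critical⇒minimal : ∀ {S G} → CriticallyForcing S G → ∀ (H : Subgraph G) → Proper H → ¬ ForcingSub S H
critical⇒minimal {S} {G} cf H proper forcing with proper⇒missing-edge (covered cf) H proper
... | e , e∉H with critical cf e
... | x , x∉S , f , c , fs≡0 , ft≡x =
  x∉S (Equivalence.from (forcing x) (colouring H f respects , fs≡0 , ft≡x))
  where
  respects : ∀ e′ → ekeep H e′ ≡ true → Respects f (lookup (edges G) e′)
  respects e′ e′∈H = All-removeAt-lookup (edges G) c e′
    λ e′≡e → case trans (sym e′∈H) (trans (cong (ekeep H) e′≡e) e∉H) of λ ()

lemma3p5 : ∀ {I : Idx} {G : TwoTerminal} → T I G → MinimallyForcing (setOf I) G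
lemma3p5 d = critical⇒forcing (T⇒critical d) , critical⇒minimal (T⇒critical d)
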